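{- If $r\ge 1$ is an integer and $A\subseteq\mathbb{F}_2^r$ is a round set, then $|A|\le|D(A)|+t$, where $t$ is the matching number of $\Gamma(A)$.
   Context: $\mathbb{F}_2^r$ denotes the elementary abelian $2$-group of rank $r$. For $X\subseteq\mathbb{F}_2^r$, $2X:=\{x_1+x_2\colon x_1,x_2\in X\}$ (with $x_1=x_2$ allowed). A set $A$ is round if $2B\ne 2A$ for every proper subset $B\subsetneq A$. $D(A)$ is the set of elements of $\mathbb{F}_2^r$ having exactly one representation, up to the order of summands, as $a_1+a_2$ with $a_1,a_2\in A$. $\Gamma(A)$ is the graph with vertex set $A$ in which distinct $a_1,a_2\in A$ are adjacent iff $a_1+a_2\in D(A)$. The matching number of a graph is the largest number of edges in a matching. -}

module Defs where

open import Data.Bool using (Bool; _xor_)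
open import Data.Nat using (ℕ; _≤_)
open import Data.Vec using (Vec; zipWith)
open import Data.List using (List; []; _∷_; length; concatMap)
open import Data.List.Membership.Propositional using (_∈_; _∉_)
open import Data.List.Relation.Unary.All using (All)
open import Data.List.Relation.Unary.Unique.Propositional using (Unique)
open import Data.Product using (_×_; _,_; ∃; ∃-syntax; Σ-syntax)
open import Data.Sum using (_⊎_)
open import Relation.Binary.PropositionalEquality using (_≡_; _≢_)
open import Relation.Nullary using (¬_)

F₂^ : ℕ → Set
F₂^ r = Vec Bool r

infixl 6 _⊕_
_⊕_ : ∀ {r} → F₂^ r → F₂^ r → F₂^ r
_⊕_ = zipWith _xor_

-- A finite subset of F_2^r is given by a list (membership = list membership).
-- Its cardinality is the length of the list when the list is duplicate-free.

-- z ∈ 2X  (x₁ = x₂ allowed)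
In2 : ∀ {r} → List (F₂^ r) → F₂^ r → Set
In2 X z = ∃[ x₁ ] ∃[ x₂ ] (x₁ ∈ X × x₂ ∈ X × z ≡ x₁ ⊕ x₂)

ProperSubset : ∀ {r} → List (F₂^ r) → List (F₂^ r) → Set
ProperSubset B A = (∀ x → x ∈ B → x ∈ A) × (∃[ a ] (a ∈ A × a ∉ B))

SameSumset : ∀ {r} → List (F₂^ r) → List (F₂^ r) → Set
SameSumset B A = ∀ z → (In2 B z → In2 A z) × (In2 A z → In2 B z)

Round : ∀ {r} → List (F₂^ r) → Set
Round {r} A = ∀ (B : List (F₂^ r)) → ProperSubset B A → ¬ SameSumset B A

InD : ∀ {r} → List (F₂^ r) → F₂^ r → Set
InD A z = ∃[ a₁ ] ∃[ a₂ ] (a₁ ∈ A × a₂ ∈ A × z ≡ a₁ ⊕ a₂ ×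
            (∀ b₁ b₂ → b₁ ∈ A → b₂ ∈ A → z ≡ b₁ ⊕ b₂ →
               (b₁ ≡ a₁ × b₂ ≡ a₂) ⊎ (b₁ ≡ a₂ × b₂ ≡ a₁)))

EdgeΓ : ∀ {r} → List (F₂^ r) → F₂^ r → F₂^ r → Set
EdgeΓ A a₁ a₂ = a₁ ∈ A × a₂ ∈ A × a₁ ≢ a₂ × InD A (a₁ ⊕ a₂)

-- A matching in Γ(A): a list of edges whose endpoints are pairwise distinct
-- (so the edges are distinct and pairwise vertex-disjoint); its size is its length.
endpoints : ∀ {r} → List (F₂^ r × F₂^ r) → List (F₂^ r)
endpoints = concatMap (λ { (x , y) → x ∷ y ∷ [] })

IsMatching : ∀ {r} → List (F₂^ r) → List (F₂^ r × F₂^ r) → Set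
IsMatching A M = All (λ { (x , y) → EdgeΓ A x y }) M × Unique (endpoints M)

IsMatchingNumber : ∀ {r} → List (F₂^ r) → ℕ → Set
IsMatchingNumber A t =
  (∃[ M ] (IsMatching A M × length M ≡ t)) ×
  (∀ M → IsMatching A M → length M ≤ t)

module Submission where

-- Let A ⊆ F₂^r be round with |A| ≥ 2.
--  (1) Every a ∈ A has a neighbour in Γ(A).  Indeed 2(A ∖ {a}) ≠ 2A, so some
--      z ∈ 2A is not a sum of two elements of A ∖ {a}; as a + a = 0 = c + c for
--      any c ≠ a, we get z = a + a' with a' ≠ a, and every representation of z
--      must use a, hence is {a, a'}: the edge a — a' lies in Γ(A).
--  (2) Fix a maximum matching M of Γ(A) and let U be the vertices it leaves
--      uncovered; give each u ∈ U a neighbour v(u).  The labels x + y of the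
--      edges of M and u + v(u) of these "pendant" edges all lie in D(A), and they
--      are pairwise distinct: an element of D(A) determines its summands, M is
--      vertex-disjoint, U is duplicate-free, and v(u) is covered by M (otherwise
--      M + {u, v(u)} would be a larger matching).
--  Hence |M| + |U| ≤ |D(A)|, while |A| ≤ 2|M| + |U|, giving |A| ≤ |D(A)| + |M|.

open import Defs
open import Data.Nat using (ℕ; suc; _≤_; _+_; z≤n; s≤s)
open import Data.Nat.Properties using (≤-trans; +-monoˡ-≤; +-assoc; +-comm; +-suc; 1+n≰n; module ≤-Reasoning)
open import Data.Bool using (false)
import Data.Bool.Properties as Bool
open import Data.Vec using (replicate; []; _∷_)
open import Data.Vec.Properties using (≡-dec; zipWith-comm; zipWith-assoc; zipWith-identityˡ)
open import Data.List using (List; []; _∷_; length; filter; map; _++_)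
open import Data.List.Properties using (filter-notAll; length-++; length-map)
open import Data.List.Membership.Propositional using (_∈_; _∉_; find; lose; mapWith∈)
open import Data.List.Membership.Propositional.Properties using (∈-filter⁺; ∈-filter⁻; ∈-++⁻; ∈-++⁺ˡ; ∈-++⁺ʳ; ∈-map⁻)
import Data.List.Membership.DecPropositional as DecMembership
open import Data.List.Membership.Setoid.Properties using (length-mapWith∈)
open import Data.List.Relation.Unary.Any using (Any; here; there; any?)
import Data.List.Relation.Unary.Any as Any
open import Data.List.Relation.Unary.Any.Properties using (mapWith∈⁻)
open import Data.List.Relation.Unary.All using (All; []; _∷_)
import Data.List.Relation.Unary.All as All
open import Data.List.Relation.Unary.All.Properties using (¬Any⇒All¬)
open import Data.List.Relation.Unary.AllPairs using (AllPairs; []; _∷_)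
import Data.List.Relation.Unary.AllPairs.Properties as AllPairs
open import Data.List.Relation.Unary.Unique.Propositional using (Unique)
open import Data.List.Relation.Unary.Unique.Propositional.Properties using (++⁺; filter⁺)
open import Data.Product using (_×_; _,_; proj₁; proj₂; ∃)
open import Data.Sum using (_⊎_; inj₁; inj₂)
open import Data.Empty using (⊥-elim)
open import Function using (_∘_)
open import Relation.Binary.Definitions using (DecidableEquality)
open import Relation.Binary.PropositionalEquality using (_≡_; _≢_; refl; sym; trans; cong; cong₂; subst; setoid; module ≡-Reasoning)
open import Relation.Nullary using (¬_; Dec; yes; no; ¬?)
open import Relation.Nullary.Decidable using (_×-dec_; decidable-stable)

𝟘 : {r : ℕ} → F₂^ r
𝟘 {r} = replicate r false

⊕-self : {r : ℕ} (x : F₂^ r) → x ⊕ x ≡ 𝟘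
⊕-self []      = refl
⊕-self (b ∷ x) = cong₂ _∷_ (Bool.xor-same b) (⊕-self x)

module _ {r : ℕ} where

  ⊕-comm : (x y : F₂^ r) → x ⊕ y ≡ y ⊕ x
  ⊕-comm = zipWith-comm Bool.xor-comm

  ⊕-assoc : (x y z : F₂^ r) → (x ⊕ y) ⊕ z ≡ x ⊕ (y ⊕ z)
  ⊕-assoc = zipWith-assoc Bool.xor-assoc

  ⊕-identityˡ : (x : F₂^ r) → 𝟘 ⊕ x ≡ x
  ⊕-identityˡ = zipWith-identityˡ Bool.xor-identityˡ

  ⊕-cancelˡ : (x y : F₂^ r) → x ⊕ (x ⊕ y) ≡ y
  ⊕-cancelˡ x y = begin
    x ⊕ (x ⊕ y)  ≡⟨ sym (⊕-assoc x x y) ⟩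
    (x ⊕ x) ⊕ y  ≡⟨ cong (_⊕ y) (⊕-self x) ⟩
    𝟘 ⊕ y        ≡⟨ ⊕-identityˡ y ⟩
    y            ∎
    where open ≡-Reasoning

  ⊕-injectiveʳ : (x : F₂^ r) {y z : F₂^ r} → x ⊕ y ≡ x ⊕ z → y ≡ z
  ⊕-injectiveʳ x {y} {z} e = trans (sym (⊕-cancelˡ x y)) (trans (cong (x ⊕_) e) (⊕-cancelˡ x z))

  _≟_ : DecidableEquality (F₂^ r)
  _≟_ = ≡-dec Bool._≟_

  In2? : (X : List (F₂^ r)) (z : F₂^ r) → Dec (In2 X z)
  In2? X z with any? (λ x₁ → any? (λ x₂ → z ≟ (x₁ ⊕ x₂)) X) X
  ... | yes p = let (x₁ , m₁ , q) = find p ; (x₂ , m₂ , e) = find q in yes (x₁ , x₂ , m₁ , m₂ , e)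
  ... | no ¬p = no λ { (x₁ , x₂ , m₁ , m₂ , e) → ¬p (lose m₁ (lose m₂ e)) }

length-≤-⊆ : ∀ {a} {X : Set a} → DecidableEquality X → {xs ys : List X} →
             Unique xs → (∀ {x} → x ∈ xs → x ∈ ys) → length xs ≤ length ys
length-≤-⊆ _≟ₓ_ {[]}     _          _   = z≤n
length-≤-⊆ {X = X} _≟ₓ_ {x ∷ xs} {ys} (x∉xs ∷ u) xs⊆ys =
  ≤-trans (s≤s (length-≤-⊆ _≟ₓ_ u xs⊆ys∖x)) (filter-notAll ≢x? ys x∈ys)
  where
  ≢x? : (y : X) → Dec (y ≢ x)
  ≢x? y = ¬? (y ≟ₓ x)
  -- removing x from ys keeps the rest of xs and makes ys strictly shorter
  xs⊆ys∖x : ∀ {y} → y ∈ xs → y ∈ filter ≢x? ys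
  xs⊆ys∖x m = ∈-filter⁺ ≢x? (xs⊆ys (there m)) (λ e → All.lookup x∉xs m (sym e))
  x∈ys : Any (λ y → ¬ (¬ y ≡ x)) ys
  x∈ys = Any.map (λ e ne → ne (sym e)) (xs⊆ys (here refl))

mapWith∈-unique : ∀ {a b} {X : Set a} {Y : Set b} {xs : List X} (f : ∀ {x} → x ∈ xs → Y) →
                  Unique xs → (∀ {x y} (p : x ∈ xs) (q : y ∈ xs) → f p ≡ f q → x ≡ y) →
                  Unique (mapWith∈ xs f)
mapWith∈-unique {xs = []}     f []         inj = []
mapWith∈-unique {xs = x ∷ xs} f (x∉xs ∷ u) inj =
  All.tabulate head-new ∷ mapWith∈-unique (f ∘ there) u (λ p q → inj (there p) (there q))
  where
  head-new : ∀ {z} → z ∈ mapWith∈ xs (f ∘ there) → f (here refl) ≢ z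
  head-new m e with mapWith∈⁻ xs (f ∘ there) m
  ... | (y , q , z≡fq) = All.lookup x∉xs q (inj (here refl) (there q) (trans e z≡fq))

module _ {r : ℕ} (A : List (F₂^ r)) where

  InD-summand : ∀ {z b₁ b₂ c₁ c₂} → InD A z →
                b₁ ∈ A → b₂ ∈ A → z ≡ b₁ ⊕ b₂ → c₁ ∈ A → c₂ ∈ A → z ≡ c₁ ⊕ c₂ →
                c₁ ≡ b₁ ⊎ c₁ ≡ b₂
  InD-summand (_ , _ , _ , _ , _ , unique) mb₁ mb₂ eb mc₁ mc₂ ec
    with unique _ _ mb₁ mb₂ eb | unique _ _ mc₁ mc₂ ec
  ... | inj₁ (p , _) | inj₁ (p' , _) = inj₁ (trans p' (sym p))
  ... | inj₁ (_ , q) | inj₂ (p' , _) = inj₂ (trans p' (sym q))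
  ... | inj₂ (_ , q) | inj₁ (p' , _) = inj₂ (trans p' (sym q))
  ... | inj₂ (p , _) | inj₂ (p' , _) = inj₁ (trans p' (sym p))

  same-label⇒shared-endpoint : ∀ {x y x' y'} → EdgeΓ A x y → EdgeΓ A x' y' →
                               x ⊕ y ≡ x' ⊕ y' → x' ≡ x ⊎ x' ≡ y
  same-label⇒shared-endpoint (mx , my , _ , d) (mx' , my' , _ , _) e =
    InD-summand d mx my refl mx' my' e

module _ {r : ℕ} {A : List (F₂^ r)} {a : F₂^ r} where

  ≢a? : (x : F₂^ r) → Dec (x ≢ a)
  ≢a? x = ¬? (x ≟ a)

  A∖a : List (F₂^ r)
  A∖a = filter ≢a? A

  ∈-A∖a : ∀ {x} → x ∈ A → x ≢ a → x ∈ A∖a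
  ∈-A∖a = ∈-filter⁺ ≢a?

  ∈-A∖a⁻ : ∀ {x} → x ∈ A∖a → x ∈ A × x ≢ a
  ∈-A∖a⁻ = ∈-filter⁻ ≢a? {xs = A}

  A∖a-proper : a ∈ A → ProperSubset A∖a A
  A∖a-proper ma = (λ _ m → proj₁ (∈-A∖a⁻ m)) , (a , ma , λ m → proj₂ (∈-A∖a⁻ m) refl)

  -- If a + a' ∉ 2(A ∖ {a}) then every representation of a + a' uses a, so it is {a, a'}.
  sum-outside⇒edge : ∀ {a'} → a ∈ A → a' ∈ A → a' ≢ a → ¬ In2 A∖a (a ⊕ a') → EdgeΓ A a a'
  sum-outside⇒edge {a'} ma ma' a'≢a outside =
    ma , ma' , (λ e → a'≢a (sym e)) , (a , a' , ma , ma' , refl , only-rep)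
    where
    only-rep : ∀ b₁ b₂ → b₁ ∈ A → b₂ ∈ A → a ⊕ a' ≡ b₁ ⊕ b₂ →
               (b₁ ≡ a × b₂ ≡ a') ⊎ (b₁ ≡ a' × b₂ ≡ a)
    only-rep b₁ b₂ m₁ m₂ e with b₁ ≟ a | b₂ ≟ a
    ... | yes b₁≡a | _        = inj₁ (b₁≡a , sym (⊕-injectiveʳ a (trans e (cong (_⊕ b₂) b₁≡a))))
    ... | no _     | yes b₂≡a =
      inj₂ (sym (⊕-injectiveʳ a (trans e (trans (⊕-comm b₁ b₂) (cong (_⊕ b₁) b₂≡a)))) , b₂≡a)
    ... | no b₁≢a  | no b₂≢a  = ⊥-elim (outside (b₁ , b₂ , ∈-A∖a m₁ b₁≢a , ∈-A∖a m₂ b₂≢a , e))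

  -- Conversely, if all sums a + a' (a' ≠ a) lie in 2(A ∖ {a}) and some c ≠ a is in A,
  -- removing a does not change the sumset (a + a = c + c covers the remaining case).
  sums-through-a⇒same-sumset : ∀ {c} → c ∈ A → c ≢ a →
    (∀ {a'} → a' ∈ A → a' ≢ a → In2 A∖a (a ⊕ a')) → SameSumset A∖a A
  sums-through-a⇒same-sumset {c} mc c≢a through z = shrink , grow
    where
    shrink : In2 A∖a z → In2 A z
    shrink (x₁ , x₂ , m₁ , m₂ , e) = x₁ , x₂ , proj₁ (∈-A∖a⁻ m₁) , proj₁ (∈-A∖a⁻ m₂) , e
    retarget : ∀ {w} → z ≡ w → In2 A∖a w → In2 A∖a z
    retarget e (x₁ , x₂ , m₁ , m₂ , e') = x₁ , x₂ , m₁ , m₂ , trans e e'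
    grow : In2 A z → In2 A∖a z
    grow (x₁ , x₂ , m₁ , m₂ , e) with x₁ ≟ a | x₂ ≟ a
    ... | yes refl | yes refl = c , c , ∈-A∖a mc c≢a , ∈-A∖a mc c≢a , trans e (trans (⊕-self a) (sym (⊕-self c)))
    ... | yes refl | no x₂≢a  = retarget e (through m₂ x₂≢a)
    ... | no x₁≢a  | yes refl = retarget (trans e (⊕-comm x₁ a)) (through m₁ x₁≢a)
    ... | no x₁≢a  | no x₂≢a  = x₁ , x₂ , ∈-A∖a m₁ x₁≢a , ∈-A∖a m₂ x₂≢a , e

  -- Step (1) proper: some a' ≠ a has a + a' ∉ 2(A ∖ {a}), since otherwise A ∖ {a}
  -- would be a proper subset with the same sumset.
  round⇒neighbour : Round A → a ∈ A → ∀ {c} → c ∈ A → c ≢ a → ∃ (EdgeΓ A a)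
  round⇒neighbour round ma mc c≢a with any? (λ a' → ¬? (a' ≟ a) ×-dec ¬? (In2? A∖a (a ⊕ a'))) A
  ... | yes p = let (a' , ma' , (a'≢a , outside)) = find p in a' , sum-outside⇒edge ma ma' a'≢a outside
  ... | no ¬p = ⊥-elim (round A∖a (A∖a-proper ma) (sums-through-a⇒same-sumset mc c≢a through))
    where
    through : ∀ {a'} → a' ∈ A → a' ≢ a → In2 A∖a (a ⊕ a')
    through ma' a'≢a = decidable-stable (In2? A∖a _) (λ outside → ¬p (lose ma' (a'≢a , outside)))

round⇒no-isolated-vertex : ∀ {r} {A : List (F₂^ r)} {a b} → Round A → a ∈ A → b ∈ A → a ≢ b →
                           ∀ u → u ∈ A → ∃ (EdgeΓ A u)
round⇒no-isolated-vertex {a = a} round ma mb a≢b u mu with u ≟ a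
... | yes refl = round⇒neighbour round mu mb (λ b≡a → a≢b (sym b≡a))
... | no u≢a   = round⇒neighbour round mu ma (λ a≡u → u≢a (sym a≡u))

module _ {r : ℕ} where

  label : F₂^ r × F₂^ r → F₂^ r
  label (x , y) = x ⊕ y

  endpoints-length : (M : List (F₂^ r × F₂^ r)) → length (endpoints M) ≡ length M + length M
  endpoints-length []      = refl
  endpoints-length (_ ∷ M) = cong suc (trans (cong suc (endpoints-length M)) (sym (+-suc (length M) (length M))))

  ∈-endpoints : ∀ {M : List (F₂^ r × F₂^ r)} {x y} → (x , y) ∈ M → x ∈ endpoints M × y ∈ endpoints M
  ∈-endpoints {_ ∷ _} (here refl) = here refl , there (here refl)
  ∈-endpoints {_ ∷ M} (there m)   = let (mx , my) = ∈-endpoints {M} m in there (there mx) , there (there my)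

  matching-extend : ∀ {A : List (F₂^ r)} {M u v} → IsMatching A M → EdgeΓ A u v →
                    u ∉ endpoints M → v ∉ endpoints M → IsMatching A ((u , v) ∷ M)
  matching-extend (edges , disjoint) E@(_ , _ , u≢v , _) u-free v-free =
    E ∷ edges , (u≢v ∷ ¬Any⇒All¬ _ u-free) ∷ ¬Any⇒All¬ _ v-free ∷ disjoint

  matching-labels-unique : ∀ {A} (M : List (F₂^ r × F₂^ r)) → IsMatching A M → Unique (map label M)
  matching-labels-unique {A} M isM = AllPairs.map⁺ (distinct M isM)
    where
    distinct : ∀ N → IsMatching A N → AllPairs (λ e e' → label e ≢ label e') N
    distinct []            _                                        = []
    distinct ((x , y) ∷ N) (E ∷ edges , (x-new ∷ y-new ∷ disjoint)) =
      All.tabulate head-new ∷ distinct N (edges , disjoint)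
      where
      head-new : ∀ {e'} → e' ∈ N → label (x , y) ≢ label e'
      head-new {x' , y'} m e with same-label⇒shared-endpoint A E (All.lookup edges m) e
      ... | inj₁ x'≡x = All.lookup (All.tail x-new) (proj₁ (∈-endpoints {N} m)) (sym x'≡x)
      ... | inj₂ x'≡y = All.lookup y-new (proj₁ (∈-endpoints {N} m)) (sym x'≡y)

module MaximumMatching {r : ℕ} (A : List (F₂^ r)) (uA : Unique A)
  (M : List (F₂^ r × F₂^ r)) (isM : IsMatching A M)
  (maximum : ∀ N → IsMatching A N → length N ≤ length M)
  (neighbour : ∀ u → u ∈ A → ∃ (EdgeΓ A u)) where

  open DecMembership (_≟_ {r}) using (_∈?_)

  covered : List (F₂^ r)
  covered = endpoints M

  uncovered? : (u : F₂^ r) → Dec (u ∉ covered)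
  uncovered? u = ¬? (u ∈? covered)

  U : List (F₂^ r)
  U = filter uncovered? A

  ∈-U⁻ : ∀ {u} → u ∈ U → u ∈ A × u ∉ covered
  ∈-U⁻ = ∈-filter⁻ uncovered? {xs = A}

  -- A neighbour of an uncovered vertex is covered, since M is maximum.
  neighbour-covered : ∀ {u v} → u ∉ covered → EdgeΓ A u v → v ∈ covered
  neighbour-covered {u} {v} u-free E with v ∈? covered
  ... | yes v-covered = v-covered
  ... | no v-free     = ⊥-elim (1+n≰n (maximum _ (matching-extend isM E u-free v-free)))

  partner : ∀ {u} → u ∈ U → F₂^ r
  partner {u} m = proj₁ (neighbour u (proj₁ (∈-U⁻ m)))

  partner-edge : ∀ {u} (m : u ∈ U) → EdgeΓ A u (partner m)
  partner-edge {u} m = proj₂ (neighbour u (proj₁ (∈-U⁻ m)))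

  -- labels of the pendant edges u — v(u); they are distinct since v(u) is covered
  pendant-labels : List (F₂^ r)
  pendant-labels = mapWith∈ U (λ {u} m → u ⊕ partner m)

  pendant-labels-unique : Unique pendant-labels
  pendant-labels-unique = mapWith∈-unique _ (filter⁺ uncovered? uA) injective
    where
    injective : ∀ {u u'} (p : u ∈ U) (q : u' ∈ U) → u ⊕ partner p ≡ u' ⊕ partner q → u ≡ u'
    injective p q e with same-label⇒shared-endpoint A (partner-edge p) (partner-edge q) e
    ... | inj₁ u'≡u = sym u'≡u
    ... | inj₂ u'≡v = ⊥-elim (proj₂ (∈-U⁻ q)
            (subst (_∈ covered) (sym u'≡v) (neighbour-covered (proj₂ (∈-U⁻ p)) (partner-edge p))))

  labels : List (F₂^ r)
  labels = map label M ++ pendant-labels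

  labels-unique : Unique labels
  labels-unique = ++⁺ (matching-labels-unique M isM) pendant-labels-unique disjoint
    where
    disjoint : ∀ {z} → ¬ (z ∈ map label M × z ∈ pendant-labels)
    disjoint (m₁ , m₂) with ∈-map⁻ label m₁ | mapWith∈⁻ U _ m₂
    ... | ((x , y) , xy∈M , refl) | (u , p , e)
      with same-label⇒shared-endpoint A (All.lookup (proj₁ isM) xy∈M) (partner-edge p) e
    ... | inj₁ refl = proj₂ (∈-U⁻ p) (proj₁ (∈-endpoints {M = M} xy∈M))
    ... | inj₂ refl = proj₂ (∈-U⁻ p) (proj₂ (∈-endpoints {M = M} xy∈M))

  labels⊆D : ∀ {z} → z ∈ labels → InD A z
  labels⊆D m with ∈-++⁻ (map label M) m
  ... | inj₁ m₁ with ∈-map⁻ label m₁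
  ...   | (_ , xy∈M , refl) = proj₂ (proj₂ (proj₂ (All.lookup (proj₁ isM) xy∈M)))
  labels⊆D m | inj₂ m₂ with mapWith∈⁻ U _ m₂
  ...   | (_ , p , refl) = proj₂ (proj₂ (proj₂ (partner-edge p)))

  labels-length : length labels ≡ length M + length U
  labels-length = trans (length-++ (map label M))
    (cong₂ _+_ (length-map label M) (length-mapWith∈ (setoid (F₂^ r)) U))

  A⊆covered++U : ∀ {a} → a ∈ A → a ∈ covered ++ U
  A⊆covered++U {a} m with a ∈? covered
  ... | yes a-covered = ∈-++⁺ˡ a-covered
  ... | no a-free     = ∈-++⁺ʳ covered (∈-filter⁺ uncovered? m a-free)

  bound : (DA : List (F₂^ r)) → (∀ z → InD A z → z ∈ DA) → length A ≤ length DA + length M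
  bound DA D⊆DA = begin
    length A                          ≤⟨ length-≤-⊆ _≟_ uA A⊆covered++U ⟩
    length (covered ++ U)             ≡⟨ length-++ covered ⟩
    length covered + length U         ≡⟨ cong (_+ length U) (endpoints-length M) ⟩
    (length M + length M) + length U  ≡⟨ +-assoc (length M) (length M) (length U) ⟩
    length M + (length M + length U)  ≡⟨ +-comm (length M) (length M + length U) ⟩
    (length M + length U) + length M  ≡⟨ cong (_+ length M) (sym labels-length) ⟩
    length labels + length M          ≤⟨ +-monoˡ-≤ (length M) (length-≤-⊆ _≟_ labels-unique (D⊆DA _ ∘ labels⊆D)) ⟩
    length DA + length M              ∎
    where open ≤-Reasoning

corollary4p12 : (r : ℕ) → 1 ≤ r →
    (A : List (F₂^ r)) → Unique A → Round A →
    (DA : List (F₂^ r)) → Unique DA → (∀ z → (z ∈ DA → InD A z) × (InD A z → z ∈ DA)) →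
    (t : ℕ) → IsMatchingNumber A t →
    length A ≤ length DA + t
corollary4p12 r _ [] _ _ DA _ _ t _ = z≤n
-- A = {a}: D(A) = {0} is nonempty.
corollary4p12 r _ (a ∷ []) _ _ DA _ D≡DA t _ = nonempty (proj₂ (D≡DA (a ⊕ a)) a+a∈D)
  where
  a+a∈D : InD (a ∷ []) (a ⊕ a)
  a+a∈D = a , a , here refl , here refl , refl , λ { _ _ (here refl) (here refl) _ → inj₁ (refl , refl) }
  nonempty : ∀ {xs} → a ⊕ a ∈ xs → 1 ≤ length xs + t
  nonempty {_ ∷ _} _ = s≤s z≤n
-- |A| ≥ 2: every vertex has a neighbour, and a maximum matching has t edges.
corollary4p12 r _ A@(_ ∷ _ ∷ _) uA@((a≢b ∷ _) ∷ _) round DA _ D≡DA t ((M , isM , refl) , maximum) =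
  MaximumMatching.bound A uA M isM maximum
    (round⇒no-isolated-vertex round (here refl) (there (here refl)) a≢b)
    DA (λ z → proj₂ (D≡DA z))
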